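{- Let $\mathbf{OMSupGal}$ be the full subcategory of $\mathbf{OMLatGal}$ on the complete orthomodular lattices. The forgetful functor $U\colon\mathbf{OMSupGal}\to\mathbf{Sets}$ given by $U(X)=X$ and $U(f)(x)=f_*(x^\perp)$ has a left adjoint $F$ given by $F(A)=\mathcal{P}(A)$ (the powerset Boolean algebra, with complement $\neg$) and, for a function $g\colon A\to B$, $F(g)_*(V)=\neg\{g(a): a\in V\}$ for $V\subseteq A$ and $F(g)^*(W)=\{a\in A: g(a)\notin W\}$ for $W\subseteq B$.
   Context: An orthomodular lattice is a bounded lattice with orthocomplement $x\mapsto x^\perp$ ($x^{\perp\perp}=x$, order-reversing, $x\wedge x^\perp=0$) with $x\le y\Rightarrow y=x\vee(x^\perp\wedge y)$; it is complete if all subsets have joins. $\mathbf{OMLatGal}$: objects orthomodular lattices; morphisms $f\colon X\to Y$ pairs $(f_*,f^*)$ of order-reversing maps $f_*\colon X\to Y$, $f^*\colon Y\to X$ with $x\le f^*(y)\iff y\le f_*(x)$; identity $((-)^\perp,(-)^\perp)$; composition $(g\circ f)_*=g_*\circ(-)^\perp\circ f_*$, $(g\circ f)^*=f^*\circ(-)^\perp\circ g^*$. -}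

module Defs where

open import Level using (0ℓ)
open import Data.Bool using (Bool; true; false; T; not; if_then_else_) renaming (_∧_ to _&&_; _∨_ to _||_)
open import Data.Unit using (tt)
open import Data.Empty using (⊥; ⊥-elim)
open import Data.Product using (Σ; _×_; _,_; proj₁; proj₂; ∃)
open import Relation.Nullary using (Dec; yes; no; does; ¬_)
open import Relation.Binary.PropositionalEquality using (_≡_; refl; subst; sym)
open import Axiom.ExcludedMiddle using (ExcludedMiddle)
open import Function using (_∘_; id)

-- Complete orthomodular lattices.
-- The lattice is presented by its order _≤_ (a preorder); equality of
-- elements is x ≈ y := x ≤ y × y ≤ x (so antisymmetry holds by fiat).

record CompleteOML : Set₁ where
  infix 4 _≤_
  infixr 7 _∧_
  infixr 6 _∨_
  infix 8 _ᗮ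
  field
    Carrier : Set
    _≤_ : Carrier → Carrier → Set
    ≤-refl : ∀ {x} → x ≤ x
    ≤-trans : ∀ {x y z} → x ≤ y → y ≤ z → x ≤ z
    𝟘 𝟙 : Carrier
    𝟘-min : ∀ {x} → 𝟘 ≤ x
    𝟙-max : ∀ {x} → x ≤ 𝟙
    _∧_ _∨_ : Carrier → Carrier → Carrier
    ∧-lb₁ : ∀ {x y} → x ∧ y ≤ x
    ∧-lb₂ : ∀ {x y} → x ∧ y ≤ y
    ∧-glb : ∀ {x y z} → z ≤ x → z ≤ y → z ≤ x ∧ y
    ∨-ub₁ : ∀ {x y} → x ≤ x ∨ y
    ∨-ub₂ : ∀ {x y} → y ≤ x ∨ y
    ∨-lub : ∀ {x y z} → x ≤ z → y ≤ z → x ∨ y ≤ z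
    _ᗮ : Carrier → Carrier
    ᗮ-invol : ∀ {x} → (x ᗮ ᗮ ≤ x) × (x ≤ x ᗮ ᗮ)
    ᗮ-antitone : ∀ {x y} → x ≤ y → y ᗮ ≤ x ᗮ
    ᗮ-meet : ∀ {x} → (x ∧ x ᗮ ≤ 𝟘) × (𝟘 ≤ x ∧ x ᗮ)
    orthomodular : ∀ {x y} → x ≤ y →
      (y ≤ x ∨ (x ᗮ ∧ y)) × (x ∨ (x ᗮ ∧ y) ≤ y)
    complete : (S : Carrier → Set) → Σ Carrier λ j →
      (∀ x → S x → x ≤ j) × (∀ z → (∀ x → S x → x ≤ z) → j ≤ z)

open CompleteOML public using (Carrier)

_⊢_≈_ : (X : CompleteOML) → Carrier X → Carrier X → Set
X ⊢ x ≈ y = (CompleteOML._≤_ X x y) × (CompleteOML._≤_ X y x)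

record Hom (X Y : CompleteOML) : Set where
  private
    module X = CompleteOML X
    module Y = CompleteOML Y
  field
    low : X.Carrier → Y.Carrier      -- f_*
    up  : Y.Carrier → X.Carrier      -- f^*
    low-antitone : ∀ {x x'} → x X.≤ x' → low x' Y.≤ low x
    up-antitone  : ∀ {y y'} → y Y.≤ y' → up y' X.≤ up y
    galois : ∀ x y → (x X.≤ up y → y Y.≤ low x) × (y Y.≤ low x → x X.≤ up y)

open Hom public

_≈H_ : ∀ {X Y} → Hom X Y → Hom X Y → Set
_≈H_ {X} {Y} f g = (∀ x → Y ⊢ low f x ≈ low g x) × (∀ y → X ⊢ up f y ≈ up g y)

idHom : (X : CompleteOML) → Hom X X
idHom X = record
  { low = _ᗮ ; up = _ᗮ
  ; low-antitone = ᗮ-antitone ; up-antitone = ᗮ-antitone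
  ; galois = λ x y → (λ p → ≤-trans (proj₂ ᗮ-invol) (ᗮ-antitone p))
                  , (λ p → ≤-trans (proj₂ ᗮ-invol) (ᗮ-antitone p)) }
  where open CompleteOML X

infixr 9 _∘H_
_∘H_ : ∀ {X Y Z} → Hom Y Z → Hom X Y → Hom X Z
_∘H_ {X} {Y} {Z} g f = record
  { low = low g ∘ Y._ᗮ ∘ low f
  ; up = up f ∘ Y._ᗮ ∘ up g
  ; low-antitone = λ p → low-antitone g (Y.ᗮ-antitone (low-antitone f p))
  ; up-antitone = λ p → up-antitone f (Y.ᗮ-antitone (up-antitone g p))
  ; galois = λ x z →
      (λ p → proj₁ (galois g (low f x Y.ᗮ) z)
                (Y.≤-trans (Y.ᗮ-antitone (proj₁ (galois f x (up g z Y.ᗮ)) p))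
                           (proj₁ Y.ᗮ-invol)))
    , (λ p → proj₂ (galois f x (up g z Y.ᗮ))
                (Y.≤-trans (Y.ᗮ-antitone (proj₂ (galois g (low f x Y.ᗮ) z) p))
                           (proj₁ Y.ᗮ-invol)))
  }
  where
    module Y = CompleteOML Y

U₀ : CompleteOML → Set
U₀ X = Carrier X

U₁ : ∀ {X Y} → Hom X Y → U₀ X → U₀ Y
U₁ {X} f x = low f (CompleteOML._ᗮ X x)

private
  ∧-T₁ : ∀ b c → T (b && c) → T b
  ∧-T₁ true c t = tt
  ∧-T₂ : ∀ b c → T (b && c) → T c
  ∧-T₂ true c t = t
  ∧-T : ∀ b c → T b → T c → T (b && c)
  ∧-T true c _ t = t
  ∨-T₁ : ∀ b c → T b → T (b || c)
  ∨-T₁ true c _ = tt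
  ∨-T₂ : ∀ b c → T c → T (b || c)
  ∨-T₂ true c _ = tt
  ∨-T₂ false c t = t
  ∨-T : ∀ b c d → (T b → T d) → (T c → T d) → T (b || c) → T d
  ∨-T true c d f g t = f tt
  ∨-T false c d f g t = g t
  not-anti : ∀ b c → (T b → T c) → T (not c) → T (not b)
  not-anti true true f t = t
  not-anti true false f t = f tt
  not-anti false c f t = tt
  contra : ∀ b c → (T b → T (not c)) → T c → T (not b)
  contra true true f t = f tt
  contra true false f ()
  contra false c f t = tt
  not-T : ∀ c → T c → T (not c) → ⊥
  not-T true _ t = t
  notnot₁ : ∀ b → T (not (not b)) → T b
  notnot₁ true t = t
  notnot₂ : ∀ b → T b → T (not (not b))
  notnot₂ true t = t
  meet-ᗮ : ∀ b → T (b && not b) → ⊥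
  meet-ᗮ true t = t
  meet-ᗮ false t = t
  om₁ : ∀ b c → (T b → T c) → T c → T (b || (not b && c))
  om₁ true c _ _ = tt
  om₁ false c _ t = t
  om₂ : ∀ b c → (T b → T c) → T (b || (not b && c)) → T c
  om₂ true c f _ = f tt
  om₂ false c f t = t

  does-yes : ∀ {P : Set} (d : Dec P) → P → T (does d)
  does-yes (yes _) _ = tt
  does-yes (no np) p = np p
  does-true : ∀ {P : Set} (d : Dec P) → T (does d) → P
  does-true (yes p) _ = p
  does-true (no _) ()

-- Arbitrary
-- unions (completeness) require excluded middle, which is a parameter.

module Free (lem : ExcludedMiddle 0ℓ) where

  Subset : Set → Set
  Subset A = A → Bool

  _⊆_ : ∀ {A} → Subset A → Subset A → Set
  V ⊆ W = ∀ a → T (V a) → T (W a)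

  ¬ˢ : ∀ {A} → Subset A → Subset A
  ¬ˢ V a = not (V a)

  ⋃ : ∀ {A} → (Subset A → Set) → Subset A
  ⋃ S a = does (lem {Σ _ λ V → S V × T (V a)})

  image : ∀ {A B} → (A → B) → Subset A → Subset B
  image g V b = does (lem {Σ _ λ a → T (V a) × g a ≡ b})

  F₀ : Set → CompleteOML
  F₀ A = record
    { Carrier = Subset A
    ; _≤_ = _⊆_
    ; ≤-refl = λ a t → t
    ; ≤-trans = λ p q a t → q a (p a t)
    ; 𝟘 = λ _ → false
    ; 𝟙 = λ _ → true
    ; 𝟘-min = λ a ()
    ; 𝟙-max = λ a _ → tt
    ; _∧_ = λ V W a → V a && W a
    ; _∨_ = λ V W a → V a || W a
    ; ∧-lb₁ = λ {V} {W} a → ∧-T₁ (V a) (W a)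
    ; ∧-lb₂ = λ {V} {W} a → ∧-T₂ (V a) (W a)
    ; ∧-glb = λ {V} {W} p q a t → ∧-T (V a) (W a) (p a t) (q a t)
    ; ∨-ub₁ = λ {V} {W} a → ∨-T₁ (V a) (W a)
    ; ∨-ub₂ = λ {V} {W} a → ∨-T₂ (V a) (W a)
    ; ∨-lub = λ {V} {W} {Z} p q a → ∨-T (V a) (W a) (Z a) (p a) (q a)
    ; _ᗮ = ¬ˢ
    ; ᗮ-invol = λ {V} → (λ a → notnot₁ (V a)) , (λ a → notnot₂ (V a))
    ; ᗮ-antitone = λ {V} {W} p a → not-anti (V a) (W a) (p a)
    ; ᗮ-meet = λ {V} → (λ a t → meet-ᗮ (V a) t) , (λ a ())
    ; orthomodular = λ {V} {W} p →
        (λ a → om₁ (V a) (W a) (p a)) , (λ a → om₂ (V a) (W a) (p a))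
    ; complete = λ S → ⋃ S
        , (λ V s a t → does-yes lem (V , s , t))
        , (λ Z ub a t → let (V , s , t') = does-true lem t in ub V s a t')
    }

  private
    galois-F₁ : ∀ {A B} (g : A → B) (V : Subset A) (W : Subset B) →
      (V ⊆ (λ a → not (W (g a))) → W ⊆ ¬ˢ (image g V))
      × (W ⊆ ¬ˢ (image g V) → V ⊆ (λ a → not (W (g a))))
    galois-F₁ {A} {B} g V W = to , from
      where
        to : V ⊆ (λ a → not (W (g a))) → W ⊆ ¬ˢ (image g V)
        to h b wb with lem {Σ A λ a → T (V a) × g a ≡ b}
        ... | yes (a , va , refl) = not-T (W (g a)) wb (h a va)
        ... | no _ = tt
        from : W ⊆ ¬ˢ (image g V) → V ⊆ (λ a → not (W (g a)))
        from k a va = contra (W (g a)) (image g V (g a)) (k (g a))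
                        (does-yes lem (a , va , refl))

  F₁ : ∀ {A B} → (A → B) → Hom (F₀ A) (F₀ B)
  F₁ {A} {B} g = record
    { low = λ V → ¬ˢ (image g V)
    ; up = λ W a → not (W (g a))
    ; low-antitone = λ {V} {V'} p b →
        not-anti (image g V b) (image g V' b)
          (λ t → let (a , va , e) = does-true lem t in does-yes lem (a , p a va , e))
    ; up-antitone = λ {W} {W'} p a → not-anti (W (g a)) (W' (g a)) (p (g a))
    ; galois = galois-F₁ g
    }

  -- Functoriality of U and F, and the adjunction F ⊣ U presented as a
  -- bijection Hom(F A, X) ≅ Sets(A, U X) of hom-setoids, natural in A and X.

  record UIsFunctor : Set₁ where
    field
      U-id : ∀ X x → X ⊢ U₁ (idHom X) x ≈ x
      U-∘ : ∀ {X Y Z} (g : Hom Y Z) (f : Hom X Y) x →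
        Z ⊢ U₁ (g ∘H f) x ≈ U₁ g (U₁ f x)
      U-cong : ∀ {X Y} {f f' : Hom X Y} → f ≈H f' → ∀ x → Y ⊢ U₁ f x ≈ U₁ f' x

  record FIsFunctor : Set₁ where
    field
      F-id : ∀ A → F₁ (id {A = A}) ≈H idHom (F₀ A)
      F-∘ : ∀ {A B C} (h : B → C) (g : A → B) → F₁ (h ∘ g) ≈H (F₁ h ∘H F₁ g)
      F-cong : ∀ {A B} {g g' : A → B} → (∀ a → g a ≡ g' a) → F₁ g ≈H F₁ g'

  record FLeftAdjointToU : Set₁ where
    field
      Φ : ∀ {A X} → Hom (F₀ A) X → (A → U₀ X)
      Ψ : ∀ {A X} → (A → U₀ X) → Hom (F₀ A) X
      Φ-cong : ∀ {A X} {f f' : Hom (F₀ A) X} → f ≈H f' → ∀ a → X ⊢ Φ f a ≈ Φ f' a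
      Ψ-cong : ∀ {A X} {h h' : A → U₀ X} → (∀ a → X ⊢ h a ≈ h' a) → Ψ {A} {X} h ≈H Ψ h'
      ΦΨ : ∀ {A X} (h : A → U₀ X) a → X ⊢ Φ (Ψ {A} {X} h) a ≈ h a
      ΨΦ : ∀ {A X} (f : Hom (F₀ A) X) → Ψ (Φ f) ≈H f
      natural-A : ∀ {A A' X} (g : A' → A) (f : Hom (F₀ A) X) a' →
        X ⊢ Φ (f ∘H F₁ g) a' ≈ Φ f (g a')
      natural-X : ∀ {A X X'} (h : Hom X X') (f : Hom (F₀ A) X) a →
        X' ⊢ Φ (h ∘H f) a ≈ U₁ h (Φ f a)

module Submission where

-- The proof rests on one order-theoretic observation: in a complete
-- orthomodular lattice every family has a meet, ⋀ᵢ hᵢ = (⋁ᵢ hᵢᗮ)ᗮ.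
-- Given h : A → X, the transpose F(A) → X sends V ⊆ A to ⋀_{a ∈ V} h a
-- (lower adjoint) and x ∈ X to {a | x ≤ h a} (upper adjoint); conversely a
-- morphism f : F(A) → X is sent to a ↦ f_*{a}.  These are mutually
-- inverse because the Galois condition forces every lower adjoint out of
-- a powerset to turn unions into meets: f_*(V) = ⋀_{a ∈ V} f_*{a}
-- (lemma low-as-meet), and then f^* is determined by f_* on singletons.

open import Defs
open import Level using (0ℓ)
open import Data.Product using (Σ; _×_; _,_; proj₁; proj₂)
open import Data.Bool using (T; not)
open import Data.Bool.Properties using (not-involutive)
open import Data.Unit using (tt)
open import Data.Empty using (⊥-elim)
open import Relation.Nullary using (Dec; yes; no; does)
open import Relation.Binary.PropositionalEquality using (_≡_; refl; sym; trans; cong; subst)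
open import Axiom.ExcludedMiddle using (ExcludedMiddle)
open import Function using (_∘_; id)

does-intro : ∀ {P : Set} (d : Dec P) → P → T (does d)
does-intro (yes _) _ = tt
does-intro (no ¬p) p = ⊥-elim (¬p p)

does-elim : ∀ {P : Set} (d : Dec P) → T (does d) → P
does-elim (yes p) _ = p
does-elim (no _) ()

module CompleteOMLProperties (X : CompleteOML) where
  open CompleteOML X hiding (Carrier)

  ≈-refl : ∀ {x} → X ⊢ x ≈ x
  ≈-refl = ≤-refl , ≤-refl

  ≈-sym : ∀ {x y} → X ⊢ x ≈ y → X ⊢ y ≈ x
  ≈-sym (p , q) = q , p

  -- Since ᗮ is an antitone involution, it can be moved across ≤.
  ᗮ-swapˡ : ∀ {x y} → x ᗮ ≤ y → y ᗮ ≤ x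
  ᗮ-swapˡ p = ≤-trans (ᗮ-antitone p) (proj₁ ᗮ-invol)

  ᗮ-swapʳ : ∀ {x y} → x ≤ y ᗮ → y ≤ x ᗮ
  ᗮ-swapʳ p = ≤-trans (proj₂ ᗮ-invol) (ᗮ-antitone p)

  ᗮ-cong : ∀ {x y} → X ⊢ x ≈ y → X ⊢ (x ᗮ) ≈ (y ᗮ)
  ᗮ-cong (p , q) = ᗮ-antitone q , ᗮ-antitone p

  ⋁ : (Carrier X → Set) → Carrier X
  ⋁ S = proj₁ (complete S)

  ⋁-ub : ∀ S {x} → S x → x ≤ ⋁ S
  ⋁-ub S = proj₁ (proj₂ (complete S)) _

  ⋁-least : ∀ S {z} → (∀ x → S x → x ≤ z) → ⋁ S ≤ z
  ⋁-least S = proj₂ (proj₂ (complete S)) _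

  -- The meet of an indexed family h over the indices satisfying P,
  -- computed by De Morgan as (⋁ {h i ᗮ | P i})ᗮ.
  meetOver : ∀ {I : Set} → (I → Set) → (I → Carrier X) → Carrier X
  meetOver {I} P h = ⋁ (λ x → Σ I λ i → P i × x ≡ h i ᗮ) ᗮ

  meetOver-lb : ∀ {I} (P : I → Set) (h : I → Carrier X) {i} → P i → meetOver P h ≤ h i
  meetOver-lb P h {i} pi = ᗮ-swapˡ (⋁-ub _ (i , pi , refl))

  meetOver-greatest : ∀ {I} (P : I → Set) (h : I → Carrier X) {x} →
    (∀ i → P i → x ≤ h i) → x ≤ meetOver P h
  meetOver-greatest P h lb =
    ᗮ-swapʳ (⋁-least _ λ { _ (i , pi , refl) → ᗮ-antitone (lb i pi) })

  meetOver-antitone : ∀ {I} {P P' : I → Set} (h : I → Carrier X) →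
    (∀ i → P i → P' i) → meetOver P' h ≤ meetOver P h
  meetOver-antitone {P = P} {P'} h P⊆P' =
    meetOver-greatest P h λ i pi → meetOver-lb P' h (P⊆P' i pi)

  meetOver-monotone : ∀ {I} (P : I → Set) {h h' : I → Carrier X} →
    (∀ i → h i ≤ h' i) → meetOver P h ≤ meetOver P h'
  meetOver-monotone P {h} {h'} h≤h' =
    meetOver-greatest P h' λ i pi → ≤-trans (meetOver-lb P h pi) (h≤h' i)

  meetOver-single : ∀ {I} (P : I → Set) (h : I → Carrier X) {i₀} →
    P i₀ → (∀ i → P i → i₀ ≡ i) → X ⊢ meetOver P h ≈ h i₀
  meetOver-single P h {i₀} pi₀ unique =
    meetOver-lb P h pi₀
    , meetOver-greatest P h λ i pi → subst (λ j → h i₀ ≤ h j) (unique i pi) ≤-refl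

low-cong : ∀ {X Y} (f : Hom X Y) {x x'} → X ⊢ x ≈ x' → Y ⊢ low f x ≈ low f x'
low-cong f (p , q) = low-antitone f q , low-antitone f p

module Adjunction (lem : ExcludedMiddle 0ℓ) where
  open Free lem

  _≐_ : ∀ {A} → Subset A → Subset A → Set
  V ≐ W = V ⊆ W × W ⊆ V

  ¬¬-elim : ∀ {A} (V : Subset A) → ¬ˢ (¬ˢ V) ⊆ V
  ¬¬-elim V a = subst T (not-involutive (V a))

  ¬¬-intro : ∀ {A} (V : Subset A) → V ⊆ ¬ˢ (¬ˢ V)
  ¬¬-intro V a = subst T (sym (not-involutive (V a)))

  image-intro : ∀ {A B} (g : A → B) (V : Subset A) {a b} →
    T (V a) → g a ≡ b → T (image g V b)
  image-intro g V va e = does-intro lem (_ , va , e)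

  image-elim : ∀ {A B} (g : A → B) (V : Subset A) {b} →
    T (image g V b) → Σ A λ a → T (V a) × g a ≡ b
  image-elim g V = does-elim lem

  image-mono : ∀ {A B} (g : A → B) {V V' : Subset A} → V ⊆ V' → image g V ⊆ image g V'
  image-mono g {V} {V'} V⊆V' b t =
    let (a , va , e) = image-elim g V t in image-intro g V' (V⊆V' a va) e

  image-id : ∀ {A} (V : Subset A) → image id V ≐ V
  image-id V =
    (λ a t → let (a' , va' , e) = image-elim id V t in subst (T ∘ V) e va')
    , (λ a va → image-intro id V va refl)

  image-∘ : ∀ {A B C} (h : B → C) (g : A → B) (V : Subset A) →
    image (h ∘ g) V ≐ image h (image g V)
  image-∘ h g V =
    (λ c t → let (a , va , e) = image-elim (h ∘ g) V t
             in image-intro h (image g V) (image-intro g V va refl) e)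
    , (λ c t → let (b , gb , e) = image-elim h (image g V) t
                   (a , va , e') = image-elim g V gb
               in image-intro (h ∘ g) V va (trans (cong h e') e))

  image-cong : ∀ {A B} {g g' : A → B} → (∀ a → g a ≡ g' a) →
    (V : Subset A) → image g V ⊆ image g' V
  image-cong {g = g} {g'} g≡g' V b t =
    let (a , va , e) = image-elim g V t in image-intro g' V va (trans (sym (g≡g' a)) e)

  ｛_｝ : ∀ {A} → A → Subset A
  ｛ a ｝ b = does (lem {a ≡ b})

  ∈-｛｝ : ∀ {A} (a : A) → T (｛ a ｝ a)
  ∈-｛｝ a = does-intro lem refl

  ｛｝-unique : ∀ {A} {a b : A} → T (｛ a ｝ b) → a ≡ b
  ｛｝-unique = does-elim lem

  ｛｝-⊆ : ∀ {A} (V : Subset A) {a} → T (V a) → ｛ a ｝ ⊆ V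
  ｛｝-⊆ V va b t = subst (T ∘ V) (｛｝-unique t) va

  image-｛｝ : ∀ {A B} (g : A → B) (a : A) → image g ｛ a ｝ ≐ ｛ g a ｝
  image-｛｝ g a =
    (λ b t → let (a' , t' , e) = image-elim g ｛ a ｝ t
             in does-intro lem (trans (cong g (｛｝-unique t')) e))
    , (λ b t → image-intro g ｛ a ｝ (∈-｛｝ a) (｛｝-unique t))

  ¬ˢ-antitone : ∀ {A} {V W : Subset A} → V ⊆ W → ¬ˢ W ⊆ ¬ˢ V
  ¬ˢ-antitone {A} = CompleteOML.ᗮ-antitone (F₀ A)

  ¬ˢ-cong : ∀ {A} {V W : Subset A} → V ≐ W → ¬ˢ V ≐ ¬ˢ W
  ¬ˢ-cong {A} = CompleteOMLProperties.ᗮ-cong (F₀ A)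

  U-functor : UIsFunctor
  U-functor = record
    { U-id = λ X x → CompleteOML.ᗮ-invol X
    ; U-∘ = λ {Z = Z} g f x → CompleteOMLProperties.≈-refl Z
    ; U-cong = λ {X} f≈f' x → proj₁ f≈f' (CompleteOML._ᗮ X x)
    }

  -- On the lower adjoints F-id and F-∘ are the functoriality of the
  -- direct image; the upper adjoints agree up to cancelling ¬ˢ ¬ˢ.
  F-functor : FIsFunctor
  F-functor = record
    { F-id = λ A → (λ V → ¬ˢ-cong (image-id V))
                 , (λ W → CompleteOML.≤-refl (F₀ A) , CompleteOML.≤-refl (F₀ A))
    ; F-∘ = λ h g → (λ V → low-∘ h g V) , (λ W → ¬¬-intro (λ a → not (W (h (g a))))
                                          , ¬¬-elim (λ a → not (W (h (g a)))))
    ; F-cong = λ g≡g' →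
        (λ V → ¬ˢ-antitone (image-cong (sym ∘ g≡g') V)
             , ¬ˢ-antitone (image-cong g≡g' V))
        , (λ W → (λ a → subst (λ b → T (not (W b))) (g≡g' a))
               , (λ a → subst (λ b → T (not (W b))) (sym (g≡g' a))))
    }
    where
      low-∘ : ∀ {A B C} (h : B → C) (g : A → B) (V : Subset A) →
        ¬ˢ (image (h ∘ g) V) ≐ ¬ˢ (image h (¬ˢ (¬ˢ (image g V))))
      low-∘ h g V = ¬ˢ-cong
        ( (λ c t → image-mono h (¬¬-intro (image g V)) c (proj₁ (image-∘ h g V) c t))
        , (λ c t → proj₂ (image-∘ h g V) c (image-mono h (¬¬-elim (image g V)) c t)) )

  module _ {A : Set} {X : CompleteOML} where
    open CompleteOML X hiding (Carrier)
    open CompleteOMLProperties X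

    transpose : Hom (F₀ A) X → A → Carrier X
    transpose f a = low f ｛ a ｝

    meetOf : (A → Carrier X) → Subset A → Carrier X
    meetOf h V = meetOver (T ∘ V) h

    extend : (A → Carrier X) → Hom (F₀ A) X
    extend h = record
      { low = meetOf h
      ; up = λ x a → does (lem {x ≤ h a})
      ; low-antitone = λ V⊆V' → meetOver-antitone h V⊆V'
      ; up-antitone = λ x≤x' a t → does-intro lem (≤-trans x≤x' (does-elim lem t))
      ; galois = λ V x →
          (λ V⊆up → meetOver-greatest _ h λ a va → does-elim lem (V⊆up a va))
          , (λ x≤meet a va → does-intro lem (≤-trans x≤meet (meetOver-lb _ h va)))
      }

    up-｛｝ : (f : Hom (F₀ A) X) (x : Carrier X) (a : A) →
      (T (up f x a) → x ≤ transpose f a) × (x ≤ transpose f a → T (up f x a))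
    up-｛｝ f x a =
      (λ t → proj₁ (galois f ｛ a ｝ x) (｛｝-⊆ (up f x) t))
      , (λ x≤ → proj₂ (galois f ｛ a ｝ x) x≤ a (∈-｛｝ a))

    low-as-meet : (f : Hom (F₀ A) X) (V : Subset A) →
      X ⊢ low f V ≈ meetOf (transpose f) V
    low-as-meet f V =
      meetOver-greatest _ (transpose f) (λ a va → low-antitone f (｛｝-⊆ V va))
      , proj₁ (galois f V _)
          (λ a va → proj₂ (up-｛｝ f _ a) (meetOver-lb _ (transpose f) va))

    transpose-extend : (h : A → Carrier X) (a : A) → X ⊢ transpose (extend h) a ≈ h a
    transpose-extend h a = meetOver-single _ h (∈-｛｝ a) (λ b → ｛｝-unique)

    extend-transpose : (f : Hom (F₀ A) X) → extend (transpose f) ≈H f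
    extend-transpose f =
      (λ V → ≈-sym (low-as-meet f V))
      , (λ x → (λ a t → proj₂ (up-｛｝ f x a) (does-elim lem t))
             , (λ a t → does-intro lem (proj₁ (up-｛｝ f x a) t)))

    extend-cong : {h h' : A → Carrier X} → (∀ a → X ⊢ h a ≈ h' a) → extend h ≈H extend h'
    extend-cong h≈h' =
      (λ V → meetOver-monotone _ (proj₁ ∘ h≈h') , meetOver-monotone _ (proj₂ ∘ h≈h'))
      , (λ x → (λ a t → does-intro lem (≤-trans (does-elim lem t) (proj₁ (h≈h' a))))
             , (λ a t → does-intro lem (≤-trans (does-elim lem t) (proj₂ (h≈h' a)))))

  -- Naturality in A: (f ∘ F g)_*{a'} = f_*(¬¬ g[{a'}]) and g[{a'}] = {g a'}.
  transpose-natural : ∀ {A A' X} (g : A' → A) (f : Hom (F₀ A) X) (a' : A') →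
    X ⊢ transpose (f ∘H F₁ g) a' ≈ transpose f (g a')
  transpose-natural g f a' =
    low-cong f ( (λ a t → proj₁ (image-｛｝ g a') a (¬¬-elim (image g ｛ a' ｝) a t))
               , (λ a t → ¬¬-intro (image g ｛ a' ｝) a (proj₂ (image-｛｝ g a') a t)) )

  F⊣U : FLeftAdjointToU
  F⊣U = record
    { Φ = transpose
    ; Ψ = λ {A} {X} → extend {A} {X}
    ; Φ-cong = λ f≈f' a → proj₁ f≈f' ｛ a ｝
    ; Ψ-cong = λ {A} {X} → extend-cong {A} {X}
    ; ΦΨ = λ {A} {X} → transpose-extend {A} {X}
    ; ΨΦ = extend-transpose
    ; natural-A = transpose-natural
    ; natural-X = λ {X' = X'} h f a → CompleteOMLProperties.≈-refl X'
    }

proposition3p16 : (lem : ExcludedMiddle 0ℓ) →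
    Free.UIsFunctor lem × Free.FIsFunctor lem × Free.FLeftAdjointToU lem
proposition3p16 lem = U-functor , F-functor , F⊣U
  where open Adjunction lem
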